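{- Let $p>q\geq 1$ be integers and let $u_\beta$ be the unique fixed point of the morphism $\varphi(0)=0^p1$, $\varphi(1)=0^q1$ on $\{0,1\}^*$. Then: (1) if $0(x1)^\ell x0\in\mathcal L(u_\beta)$ for some word $x\in\{0,1\}^*$ and some integer $\ell\geq 2$, then $\ell=2$ and $x=0^q$; (2) if $1(x0)^\ell x1\in\mathcal L(u_\beta)$ for some word $x\in\{0,1\}^*$ and some integer $\ell\geq p-1$, and $p\leq 2q$, then $x$ is the empty word.
   Context: $\mathcal L(u_\beta)$ denotes the set of finite factors of $u_\beta$. -}

module Defs where

open import Data.Nat using (ℕ; zero; suc)
open import Data.List using (List; []; _∷_; _++_; concatMap; replicate)
open import Data.Product using (∃; ∃-syntax; _×_)
open import Relation.Binary.PropositionalEquality using (_≡_)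

data Bit : Set where
  b0 b1 : Bit

Word : Set
Word = List Bit

0^ : ℕ → Word
0^ k = replicate k b0

φ₁ : ℕ → ℕ → Bit → Word
φ₁ p q b0 = 0^ p ++ (b1 ∷ [])
φ₁ p q b1 = 0^ q ++ (b1 ∷ [])

φ : ℕ → ℕ → Word → Word
φ p q = concatMap (φ₁ p q)

φ^ : ℕ → ℕ → ℕ → Word → Word
φ^ p q zero    w = w
φ^ p q (suc n) w = φ p q (φ^ p q n w)

Factor : Word → Word → Set
Factor w v = ∃[ u ] ∃[ z ] (v ≡ u ++ w ++ z)

-- L(u_β): finite factors of the fixed point u_β = lim φ^n(0).
-- Since φ(0) begins with 0 (p ≥ 1), every φ^n(0) is a prefix of u_β and
-- these prefixes exhaust it, so the factors of u_β are exactly the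
-- factors of some φ^n(0).
Lang : ℕ → ℕ → Word → Set
Lang p q w = ∃[ n ] Factor w (φ^ p q n (b0 ∷ []))

pow : Word → ℕ → Word
pow w zero    = []
pow w (suc n) = w ++ pow w n

{-# OPTIONS --safe #-}
module Submission where

-- Every factor of u_β is a factor of φ(v) for a factor v of u_β = φ(u_β), and v has no factor 11
-- because both blocks φ(0) = 0^p1 and φ(1) = 0^q1 begin with 0.  Reading φ(v) as a concatenation of
-- blocks 0^p1 and 0^q1 gives three local rules: no run of p+1 zeros, every gap 10^k1 has
-- k ∈ {p, q}, and 10^q10^q1 never occurs (it would come from 11 in v).
-- If x contains a 1, write x = 0^a1… = …10^b.  The repetitions exhibit the gaps 10^a1 and 10^b1,
-- and the junction x c x exhibits 10^b c 0^a 1: for c = 1 the rules force a = b = q and then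
-- forbid the junction, for c = 0 it is a gap of length a + b + 1 ≥ 2q + 1 > p.
-- If x = 0^k, part (1) yields the gap 10^k1, so k = q (k = p gives a run 0^(p+1)), and a third
-- repetition would give 10^q10^q1; in part (2) the whole word is a gap of length ≥ ℓ + 2 > p
-- unless k = 0.

open import Defs
open import Data.Nat using (ℕ; zero; suc; _+_; _*_; _∸_; _≤_; _<_; z≤n; s≤s)
open import Data.Nat.Properties
  using (≤-refl; ≤-trans; <⇒≤; <-irrefl; n≮0; m≤n⇒m≤1+n; m<m+n; m≤m*n; m≤n+m∸n;
         ∸-monoˡ-≤; +-comm; +-mono-≤; +-monoˡ-≤; +-monoʳ-<; +-identityʳ; module ≤-Reasoning)
open import Data.List using ([]; _∷_; _++_; [_])
open import Data.List.Properties using (++-assoc; ++-identityʳ; ++-monoid; ∷-injectiveʳ)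
open import Data.Product using (_×_; _,_; ∃-syntax; proj₁; proj₂)
open import Data.Sum using (_⊎_; inj₁; inj₂)
open import Data.Empty using (⊥; ⊥-elim)
open import Relation.Nullary using (¬_)
open import Relation.Binary.PropositionalEquality
  using (_≡_; _≢_; refl; sym; trans; cong; cong₂; subst; subst₂; module ≡-Reasoning)
open import Algebra.Solver.Monoid (++-monoid Bit) using (solve; _⊜_; _⊕_; id)

Suffix : Word → Word → Set
Suffix s w = ∃[ l ] (w ≡ l ++ s)

factor-refl : ∀ w → Factor w w
factor-refl w = [] , [] , sym (++-identityʳ w)

factor-trans : ∀ {u v w} → Factor u v → Factor v w → Factor u w
factor-trans {u} (l₁ , r₁ , refl) (l₂ , r₂ , refl) =
  l₂ ++ l₁ , r₁ ++ r₂ ,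
  solve 5 (λ l₂ l₁ u r₁ r₂ → l₂ ⊕ (l₁ ⊕ u ⊕ r₁) ⊕ r₂ ⊜ (l₂ ⊕ l₁) ⊕ u ⊕ (r₁ ⊕ r₂))
        refl l₂ l₁ u r₁ r₂

suffix-factor : ∀ l w → Factor w (l ++ w)
suffix-factor l w = l , [] , cong (l ++_) (sym (++-identityʳ w))

factor-prefix : ∀ u v {w} → Factor (u ++ v) w → Factor u w
factor-prefix u v (l , r , eq) = l , v ++ r , trans eq (cong (l ++_) (++-assoc u v r))

factor-suffix : ∀ u v {w} → Factor (u ++ v) w → Factor v w
factor-suffix u v (l , r , eq) =
  l ++ u , r , trans eq (solve 4 (λ l u v r → l ⊕ (u ⊕ v) ⊕ r ⊜ (l ⊕ u) ⊕ v ⊕ r) refl l u v r)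

0^-++ : ∀ m n → 0^ m ++ 0^ n ≡ 0^ (m + n)
0^-++ zero    n = refl
0^-++ (suc m) n = cong (b0 ∷_) (0^-++ m n)

0^-snoc : ∀ n → 0^ n ++ [ b0 ] ≡ 0^ (suc n)
0^-snoc n = trans (0^-++ n 1) (cong 0^ (+-comm n 1))

0^-b1-injective : ∀ k m {z r} → 0^ k ++ b1 ∷ z ≡ 0^ m ++ b1 ∷ r → k ≡ m × z ≡ r
0^-b1-injective zero    zero    refl = refl , refl
0^-b1-injective (suc k) (suc m) eq with 0^-b1-injective k m (∷-injectiveʳ eq)
... | refl , z≡r = refl , z≡r

longer-run-≢ : ∀ j k {z r} → j < k → 0^ k ++ z ≢ 0^ j ++ b1 ∷ r
longer-run-≢ zero    (suc k) _         ()
longer-run-≢ (suc j) (suc k) (s≤s j<k) eq = longer-run-≢ j k j<k (∷-injectiveʳ eq)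

0^-split : ∀ m r u s → 0^ m ++ b1 ∷ r ≡ u ++ s →
           (∃[ j ] (j ≤ m × s ≡ 0^ j ++ b1 ∷ r)) ⊎ Suffix s r
0^-split m       r []      s eq = inj₁ (m , ≤-refl , sym eq)
0^-split zero    r (_ ∷ u) s eq = inj₂ (u , ∷-injectiveʳ eq)
0^-split (suc m) r (_ ∷ u) s eq with 0^-split m r u s (∷-injectiveʳ eq)
... | inj₁ (j , j≤m , s≡) = inj₁ (j , m≤n⇒m≤1+n j≤m , s≡)
... | inj₂ s⊒r            = inj₂ s⊒r

all-zero-or-framed : ∀ x → (∃[ k ] x ≡ 0^ k) ⊎
  (∃[ a ] ∃[ r ] ∃[ s ] ∃[ b ] (x ≡ 0^ a ++ b1 ∷ r × x ≡ s ++ b1 ∷ 0^ b))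
all-zero-or-framed [] = inj₁ (0 , refl)
all-zero-or-framed (b0 ∷ x) with all-zero-or-framed x
... | inj₁ (k , refl)                = inj₁ (suc k , refl)
... | inj₂ (a , r , s , b , ea , eb) = inj₂ (suc a , r , b0 ∷ s , b , cong (b0 ∷_) ea , cong (b0 ∷_) eb)
all-zero-or-framed (b1 ∷ x) with all-zero-or-framed x
... | inj₁ (k , refl)                = inj₂ (0 , 0^ k , [] , k , refl , refl)
... | inj₂ (a , r , s , b , ea , eb) = inj₂ (0 , x , b1 ∷ s , b , refl , cong (b1 ∷_) eb)

pow-0^ : ∀ k ℓ → pow (0^ k ++ [ b0 ]) ℓ ≡ 0^ (ℓ * suc k)
pow-0^ k zero    = refl
pow-0^ k (suc ℓ) = trans (cong₂ _++_ (0^-snoc k) (pow-0^ k ℓ)) (0^-++ (suc k) (ℓ * suc k))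

pow-prefix : ∀ x u v n → ∃[ r ] (pow (x ++ u) n ++ x ++ v ≡ x ++ r)
pow-prefix x u v zero    = v , refl
pow-prefix x u v (suc n) =
  u ++ pow (x ++ u) n ++ x ++ v ,
  solve 4 (λ x u P X → ((x ⊕ u) ⊕ P) ⊕ X ⊜ x ⊕ (u ⊕ P ⊕ X)) refl x u (pow (x ++ u) n) (x ++ v)

pow-head : ∀ c x u v n → Factor (c ∷ x) (c ∷ pow (x ++ u) n ++ x ++ v)
pow-head c x u v n with pow-prefix x u v n
... | r , eq = [] , r , cong (c ∷_) eq

square-factor : ∀ x c d n → Factor (x ++ c ∷ x) (pow (x ++ [ c ]) (suc n) ++ x ++ [ d ])
square-factor x c d n with pow-prefix x [ c ] [ d ] n
... | r , eq = [] , r , (begin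
  ((x ++ [ c ]) ++ pow (x ++ [ c ]) n) ++ x ++ [ d ]  ≡⟨ ++-assoc (x ++ [ c ]) _ _ ⟩
  (x ++ [ c ]) ++ pow (x ++ [ c ]) n ++ x ++ [ d ]    ≡⟨ cong ((x ++ [ c ]) ++_) eq ⟩
  (x ++ [ c ]) ++ x ++ r
    ≡⟨ solve 3 (λ x c r → (x ⊕ c) ⊕ x ⊕ r ⊜ (x ⊕ c ⊕ x) ⊕ r) refl x [ c ] r ⟩
  (x ++ c ∷ x) ++ r                                   ∎)
  where open ≡-Reasoning

periodic-zeros-gap : ∀ k n e → Factor (b1 ∷ 0^ k ++ [ b1 ]) (pow (0^ k ++ [ b1 ]) (2 + n) ++ e)
periodic-zeros-gap k n e = 0^ k , pow (0^ k ++ [ b1 ]) n ++ e ,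
  solve 4 (λ Z i P e → ((Z ⊕ i) ⊕ (Z ⊕ i) ⊕ P) ⊕ e ⊜ Z ⊕ (i ⊕ Z ⊕ i) ⊕ P ⊕ e)
        refl (0^ k) [ b1 ] (pow (0^ k ++ [ b1 ]) n) e

periodic-zeros-double-gap : ∀ k n e →
  Factor (b1 ∷ 0^ k ++ b1 ∷ 0^ k ++ [ b1 ]) (pow (0^ k ++ [ b1 ]) (3 + n) ++ e)
periodic-zeros-double-gap k n e = 0^ k , pow (0^ k ++ [ b1 ]) n ++ e ,
  solve 4 (λ Z i P e → ((Z ⊕ i) ⊕ (Z ⊕ i) ⊕ (Z ⊕ i) ⊕ P) ⊕ e
                     ⊜ Z ⊕ (i ⊕ Z ⊕ i ⊕ Z ⊕ i) ⊕ P ⊕ e)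
        refl (0^ k) [ b1 ] (pow (0^ k ++ [ b1 ]) n) e

periodic-zeros-run : ∀ k ℓ → pow (0^ k ++ [ b0 ]) ℓ ++ 0^ k ++ [ b1 ] ≡ 0^ (ℓ * suc k + k) ++ [ b1 ]
periodic-zeros-run k ℓ = begin
  pow (0^ k ++ [ b0 ]) ℓ ++ 0^ k ++ [ b1 ]  ≡⟨ cong (_++ 0^ k ++ [ b1 ]) (pow-0^ k ℓ) ⟩
  0^ (ℓ * suc k) ++ 0^ k ++ [ b1 ]          ≡⟨ sym (++-assoc (0^ (ℓ * suc k)) (0^ k) [ b1 ]) ⟩
  (0^ (ℓ * suc k) ++ 0^ k) ++ [ b1 ]        ≡⟨ cong (_++ [ b1 ]) (0^-++ (ℓ * suc k) k) ⟩
  0^ (ℓ * suc k + k) ++ [ b1 ]              ∎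
  where open ≡-Reasoning

module _ {x a r s b} (ea : x ≡ 0^ a ++ b1 ∷ r) (eb : x ≡ s ++ b1 ∷ 0^ b) where

  framed-junction : ∀ c → Factor (b1 ∷ 0^ b ++ c ∷ 0^ a ++ [ b1 ]) (x ++ c ∷ x)
  framed-junction c = s , r , trans (cong₂ (λ x₁ x₂ → x₁ ++ c ∷ x₂) eb ea)
    (solve 6 (λ s i B c A r → (s ⊕ i ⊕ B) ⊕ c ⊕ A ⊕ i ⊕ r
                          ⊜ s ⊕ (i ⊕ B ⊕ c ⊕ A ⊕ i) ⊕ r)
           refl s [ b1 ] (0^ b) [ c ] (0^ a) r)

  framed-head : ∀ c → Factor (c ∷ 0^ a ++ [ b1 ]) (c ∷ x)
  framed-head c = [] , r , trans (cong (c ∷_) ea)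
    (solve 4 (λ c A i r → c ⊕ A ⊕ i ⊕ r ⊜ (c ⊕ A ⊕ i) ⊕ r) refl [ c ] (0^ a) [ b1 ] r)

  framed-tail : ∀ c → Factor (b1 ∷ 0^ b ++ [ c ]) (x ++ [ c ])
  framed-tail c = s , [] , trans (cong (_++ [ c ]) eb)
    (solve 4 (λ s i B c → (s ⊕ i ⊕ B) ⊕ c ⊜ s ⊕ (i ⊕ B ⊕ c) ⊕ id) refl s [ b1 ] (0^ b) [ c ])

module _ (p q : ℕ) (1≤q : 1 ≤ q) (q<p : q < p) where

  blockLength : Bit → ℕ
  blockLength b0 = p
  blockLength b1 = q

  0<p : 0 < p
  0<p = ≤-trans (s≤s z≤n) q<p

  blockLength≤p : ∀ c → blockLength c ≤ p
  blockLength≤p b0 = ≤-refl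
  blockLength≤p b1 = <⇒≤ q<p

  blockLength≡q⇒b1 : ∀ c → q ≡ blockLength c → c ≡ b1
  blockLength≡q⇒b1 b0 q≡p = ⊥-elim (<-irrefl q≡p q<p)
  blockLength≡q⇒b1 b1 _   = refl

  φ-∷ : ∀ c v → φ p q (c ∷ v) ≡ 0^ (blockLength c) ++ b1 ∷ φ p q v
  φ-∷ b0 v = ++-assoc (0^ p) [ b1 ] (φ p q v)
  φ-∷ b1 v = ++-assoc (0^ q) [ b1 ] (φ p q v)

  φ-block : ∀ v k z → φ p q v ≡ 0^ k ++ b1 ∷ z →
            ∃[ c ] ∃[ v′ ] (v ≡ c ∷ v′ × k ≡ blockLength c × z ≡ φ p q v′)
  φ-block []      zero    _ ()
  φ-block []      (suc _) _ ()
  φ-block (c ∷ v) k       z eq with 0^-b1-injective k (blockLength c) (trans (sym eq) (φ-∷ c v))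
  ... | k≡ , z≡ = c , v , refl , k≡ , z≡

  φ-suffix : ∀ v u s → φ p q v ≡ u ++ s →
             s ≡ [] ⊎ ∃[ j ] ∃[ v′ ] (j ≤ p × Suffix v′ v × s ≡ 0^ j ++ b1 ∷ φ p q v′)
  φ-suffix []      []      s eq = inj₁ (sym eq)
  φ-suffix (c ∷ v) u       s eq with 0^-split (blockLength c) (φ p q v) u s (trans (sym (φ-∷ c v)) eq)
  ... | inj₁ (j , j≤ , s≡) = inj₂ (j , v , ≤-trans j≤ (blockLength≤p c) , ([ c ] , refl) , s≡)
  ... | inj₂ (u′ , φv≡) with φ-suffix v u′ s φv≡
  ...   | inj₁ s≡[] = inj₁ s≡[]
  ...   | inj₂ (j , v′ , j≤p , (l , v≡) , s≡) =
    inj₂ (j , v′ , j≤p , (c ∷ l , cong (c ∷_) v≡) , s≡)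

  φ-after-b1 : ∀ v u t → φ p q v ≡ u ++ b1 ∷ t → ∃[ v′ ] (Suffix v′ v × t ≡ φ p q v′)
  φ-after-b1 v u t eq with φ-suffix v u (b1 ∷ t) eq
  ... | inj₂ (zero , v′ , _ , v′⊒v , refl) = v′ , v′⊒v , refl

  φ-gap : ∀ v u k t → φ p q v ≡ u ++ b1 ∷ 0^ k ++ b1 ∷ t →
          ∃[ c ] ∃[ v′ ] (Suffix (c ∷ v′) v × k ≡ blockLength c × t ≡ φ p q v′)
  φ-gap v u k t eq with φ-after-b1 v u _ eq
  ... | v₁ , v₁⊒v , e with φ-block v₁ k t (sym e)
  ...   | c , v′ , refl , k≡ , t≡ = c , v′ , v₁⊒v , k≡ , t≡

  φ-gap-length : ∀ v k → Factor (b1 ∷ 0^ k ++ [ b1 ]) (φ p q v) → k ≡ p ⊎ k ≡ q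
  φ-gap-length v k (u , z , eq)
    with φ-gap v u k z (trans eq (cong (λ w → u ++ b1 ∷ w) (++-assoc (0^ k) [ b1 ] z)))
  ... | b0 , _ , _ , k≡p , _ = inj₁ k≡p
  ... | b1 , _ , _ , k≡q , _ = inj₂ k≡q

  φ-no-b1b1 : ∀ v → ¬ Factor (b1 ∷ b1 ∷ []) (φ p q v)
  φ-no-b1b1 v f with φ-gap-length v 0 f
  ... | inj₁ 0≡p = n≮0 (subst (0 <_) (sym 0≡p) 0<p)
  ... | inj₂ 0≡q = n≮0 (subst (0 <_) (sym 0≡q) 1≤q)

  φ-no-run : ∀ v → ¬ Factor (0^ (suc p)) (φ p q v)
  φ-no-run v (u , z , eq) with φ-suffix v u _ eq
  ... | inj₂ (j , _ , j≤p , _ , s≡) = longer-run-≢ j (suc p) (s≤s j≤p) s≡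

  φ-double-short-gap : ∀ v → Factor (b1 ∷ 0^ q ++ b1 ∷ 0^ q ++ [ b1 ]) (φ p q v) →
                       Factor (b1 ∷ b1 ∷ []) v
  φ-double-short-gap v (u , z , eq)
    with φ-gap v u q ((0^ q ++ [ b1 ]) ++ z)
               (trans eq (cong (λ w → u ++ b1 ∷ w) (++-assoc (0^ q) _ z)))
  ... | c₁ , v₁ , (l , v≡) , q≡c₁ , e₁
    with φ-block v₁ q z (trans (sym e₁) (++-assoc (0^ q) [ b1 ] z))
  ...   | c₂ , v₂ , refl , q≡c₂ , _
    rewrite blockLength≡q⇒b1 c₁ q≡c₁ | blockLength≡q⇒b1 c₂ q≡c₂ = l , v₂ , v≡

  record LocalRules (w : Word) : Set where
    field
      no-run             : ¬ Factor (0^ (suc p)) w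
      gap-length         : ∀ k → Factor (b1 ∷ 0^ k ++ [ b1 ]) w → k ≡ p ⊎ k ≡ q
      no-double-short-gap : ¬ Factor (b1 ∷ 0^ q ++ b1 ∷ 0^ q ++ [ b1 ]) w

  LocalRules-factor : ∀ {w v} → Factor w v → LocalRules v → LocalRules w
  LocalRules-factor w⊑v R = record
    { no-run             = λ f → no-run (factor-trans f w⊑v)
    ; gap-length         = λ k f → gap-length k (factor-trans f w⊑v)
    ; no-double-short-gap = λ f → no-double-short-gap (factor-trans f w⊑v)
    }
    where open LocalRules R

  φ-LocalRules : ∀ v → ¬ Factor (b1 ∷ b1 ∷ []) v → LocalRules (φ p q v)
  φ-LocalRules v no-b1b1 = record
    { no-run             = φ-no-run v
    ; gap-length         = φ-gap-length v
    ; no-double-short-gap = λ f → no-b1b1 (φ-double-short-gap v f)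
    }

  φ^-no-b1b1 : ∀ n → ¬ Factor (b1 ∷ b1 ∷ []) (φ^ p q n [ b0 ])
  φ^-no-b1b1 zero    ([]         , _ , ())
  φ^-no-b1b1 zero    (_ ∷ []     , _ , ())
  φ^-no-b1b1 zero    (_ ∷ _ ∷ _  , _ , ())
  φ^-no-b1b1 (suc n) = φ-no-b1b1 (φ^ p q n [ b0 ])

  b0-factor-φb0 : Factor [ b0 ] (φ p q [ b0 ])
  b0-factor-φb0 = subst (Factor [ b0 ]) (sym (φ-∷ b0 [])) (leading-b0 p 0<p)
    where
    leading-b0 : ∀ k → 0 < k → Factor [ b0 ] (0^ k ++ [ b1 ])
    leading-b0 (suc k) _ = [] , 0^ k ++ [ b1 ] , refl

  Lang⇒LocalRules : ∀ {w} → Lang p q w → LocalRules w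
  Lang⇒LocalRules (zero , w⊑b0) =
    LocalRules-factor (factor-trans w⊑b0 b0-factor-φb0) (φ-LocalRules [ b0 ] (φ^-no-b1b1 0))
  Lang⇒LocalRules (suc n , w⊑φ) = LocalRules-factor w⊑φ (φ-LocalRules _ (φ^-no-b1b1 n))

  open LocalRules

  gap-bounds : ∀ {k} → k ≡ p ⊎ k ≡ q → q ≤ k × k ≤ p
  gap-bounds (inj₁ refl) = <⇒≤ q<p , ≤-refl
  gap-bounds (inj₂ refl) = ≤-refl , <⇒≤ q<p

  0-bordered-zeros : ∀ k n → LocalRules (b0 ∷ pow (0^ k ++ [ b1 ]) (2 + n) ++ 0^ k ++ [ b0 ]) →
                    2 + n ≡ 2 × 0^ k ≡ 0^ q
  0-bordered-zeros k n R
    with gap-length R k (factor-trans (periodic-zeros-gap k n _) (suffix-factor [ b0 ] _))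
  ... | inj₁ refl = ⊥-elim (no-run R (pow-head b0 (0^ k) [ b1 ] [ b0 ] (2 + n)))
  0-bordered-zeros k zero    R | inj₂ refl = refl , refl
  0-bordered-zeros k (suc m) R | inj₂ refl =
    ⊥-elim (no-double-short-gap R
              (factor-trans (periodic-zeros-double-gap k m _) (suffix-factor [ b0 ] _)))

  0-bordered-framed : ∀ {x a r s b} → x ≡ 0^ a ++ b1 ∷ r → x ≡ s ++ b1 ∷ 0^ b →
            ∀ n → ¬ LocalRules (b0 ∷ pow (x ++ [ b1 ]) (suc n) ++ x ++ [ b0 ])
  0-bordered-framed {x} {a} {r} {s} {b} ea eb n R = rule-out (gap-length R a gap-a) (gap-length R b gap-b)
    where
    W = b0 ∷ pow (x ++ [ b1 ]) (suc n) ++ x ++ [ b0 ]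
    square : Factor (x ++ b1 ∷ x) W
    square = factor-trans (square-factor x b1 b0 n) (suffix-factor [ b0 ] _)
    junction : Factor (b1 ∷ 0^ b ++ b1 ∷ 0^ a ++ [ b1 ]) W
    junction = factor-trans (framed-junction ea eb b1) square
    gap-a : Factor (b1 ∷ 0^ a ++ [ b1 ]) W
    gap-a = factor-suffix (b1 ∷ 0^ b) _ junction
    gap-b : Factor (b1 ∷ 0^ b ++ [ b1 ]) W
    gap-b = factor-trans (framed-tail ea eb b1) (factor-trans ([] , x , sym (++-assoc x [ b1 ] x)) square)
    run-a : Factor (0^ (suc a)) W
    run-a = factor-trans (factor-prefix (b0 ∷ 0^ a) [ b1 ] (framed-head ea eb b0))
                         (pow-head b0 x [ b1 ] [ b0 ] (suc n))
    run-b : Factor (0^ (suc b)) W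
    run-b = factor-trans (subst (λ u → Factor u (x ++ [ b0 ])) (0^-snoc b)
                                (factor-suffix [ b1 ] _ (framed-tail ea eb b0)))
                         (suffix-factor (b0 ∷ pow (x ++ [ b1 ]) (suc n)) _)
    rule-out : a ≡ p ⊎ a ≡ q → b ≡ p ⊎ b ≡ q → ⊥
    rule-out (inj₁ a≡p) _           = no-run R (subst (λ k → Factor (0^ (suc k)) W) a≡p run-a)
    rule-out _           (inj₁ b≡p) = no-run R (subst (λ k → Factor (0^ (suc k)) W) b≡p run-b)
    rule-out (inj₂ a≡q) (inj₂ b≡q) =
      no-double-short-gap R
        (subst₂ (λ i j → Factor (b1 ∷ 0^ j ++ b1 ∷ 0^ i ++ [ b1 ]) W) a≡q b≡q junction)

  1-bordered-zeros : ∀ k n → p ≤ 2 + n →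
                    ¬ LocalRules (b1 ∷ pow (0^ (suc k) ++ [ b0 ]) (suc n) ++ 0^ (suc k) ++ [ b1 ])
  1-bordered-zeros k n p≤2+n R = <-irrefl refl (begin-strict
    p                                    ≤⟨ p≤2+n ⟩
    2 + n                                ≤⟨ +-mono-≤ (s≤s (s≤s z≤n)) (m≤m*n n (2 + k)) ⟩
    (2 + k) + n * (2 + k)                <⟨ m<m+n _ (s≤s z≤n) ⟩
    suc n * (2 + k) + suc k              ≤⟨ proj₂ (gap-bounds (gap-length R _ gap)) ⟩
    p                                    ∎)
    where
    open ≤-Reasoning
    gap : Factor (b1 ∷ 0^ (suc n * (2 + k) + suc k) ++ [ b1 ])
                 (b1 ∷ pow (0^ (suc k) ++ [ b0 ]) (suc n) ++ 0^ (suc k) ++ [ b1 ])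
    gap = subst (Factor _) (cong (b1 ∷_) (sym (periodic-zeros-run (suc k) (suc n)))) (factor-refl _)

  1-bordered-framed : ∀ {x a r s b} → x ≡ 0^ a ++ b1 ∷ r → x ≡ s ++ b1 ∷ 0^ b → p ≤ 2 * q →
            ∀ n → ¬ LocalRules (b1 ∷ pow (x ++ [ b0 ]) (suc n) ++ x ++ [ b1 ])
  1-bordered-framed {x} {a} {r} {s} {b} ea eb p≤2q n R = <-irrefl refl (begin-strict
    2 * q      ≡⟨ cong (q +_) (+-identityʳ q) ⟩
    q + q      <⟨ +-monoʳ-< q (s≤s (proj₁ (gap-bounds (gap-length R a gap-a)))) ⟩
    q + suc a  ≤⟨ +-monoˡ-≤ (suc a) (proj₁ (gap-bounds (gap-length R b gap-b))) ⟩
    b + suc a  ≤⟨ proj₂ (gap-bounds (gap-length R (b + suc a) merged-gap)) ⟩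
    p          ≤⟨ p≤2q ⟩
    2 * q      ∎)
    where
    open ≤-Reasoning
    W = b1 ∷ pow (x ++ [ b0 ]) (suc n) ++ x ++ [ b1 ]
    gap-a : Factor (b1 ∷ 0^ a ++ [ b1 ]) W
    gap-a = factor-trans (framed-head ea eb b1) (pow-head b1 x [ b0 ] [ b1 ] (suc n))
    gap-b : Factor (b1 ∷ 0^ b ++ [ b1 ]) W
    gap-b = factor-trans (framed-tail ea eb b1) (suffix-factor (b1 ∷ pow (x ++ [ b0 ]) (suc n)) _)
    merged-gap : Factor (b1 ∷ 0^ (b + suc a) ++ [ b1 ]) W
    merged-gap =
      subst (λ u → Factor (b1 ∷ u) W)
            (trans (sym (++-assoc (0^ b) (0^ (suc a)) [ b1 ])) (cong (_++ [ b1 ]) (0^-++ b (suc a))))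
            (factor-trans (framed-junction ea eb b0)
                          (factor-trans (square-factor x b0 b1 n) (suffix-factor [ b1 ] _)))

  0-bordered-repetition : (x : Word) (ℓ : ℕ) → 2 ≤ ℓ →
    Lang p q (b0 ∷ (pow (x ++ [ b1 ]) ℓ ++ x ++ [ b0 ])) → ℓ ≡ 2 × x ≡ 0^ q
  0-bordered-repetition x (suc zero)    (s≤s ()) _
  0-bordered-repetition x (suc (suc n)) _        L with all-zero-or-framed x
  ... | inj₁ (k , refl)                = 0-bordered-zeros k n (Lang⇒LocalRules L)
  ... | inj₂ (_ , _ , _ , _ , ea , eb) = ⊥-elim (0-bordered-framed ea eb (suc n) (Lang⇒LocalRules L))

  1-bordered-repetition : (x : Word) (ℓ : ℕ) → p ∸ 1 ≤ ℓ → p ≤ 2 * q →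
    Lang p q (b1 ∷ (pow (x ++ [ b0 ]) ℓ ++ x ++ [ b1 ])) → x ≡ []
  1-bordered-repetition x zero p∸1≤0 _ _ = ⊥-elim (n≮0 (≤-trans (∸-monoˡ-≤ 1 2≤p) p∸1≤0))
    where 2≤p = ≤-trans (s≤s 1≤q) q<p
  1-bordered-repetition x (suc n) p∸1≤ℓ p≤2q L with all-zero-or-framed x
  ... | inj₁ (zero , refl)             = refl
  ... | inj₁ (suc k , refl)            =
    ⊥-elim (1-bordered-zeros k n (≤-trans (m≤n+m∸n p 1) (s≤s p∸1≤ℓ)) (Lang⇒LocalRules L))
  ... | inj₂ (_ , _ , _ , _ , ea , eb) = ⊥-elim (1-bordered-framed ea eb p≤2q n (Lang⇒LocalRules L))

mainTheorem3 : (p q : ℕ) → 1 ≤ q → q < p →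
    ((x : Word) (ℓ : ℕ) → 2 ≤ ℓ →
      Lang p q (b0 ∷ (pow (x ++ b1 ∷ []) ℓ ++ x ++ b0 ∷ [])) →
      (ℓ ≡ 2) × (x ≡ 0^ q))
    × ((x : Word) (ℓ : ℕ) → p ∸ 1 ≤ ℓ → p ≤ 2 * q →
      Lang p q (b1 ∷ (pow (x ++ b0 ∷ []) ℓ ++ x ++ b1 ∷ [])) →
      x ≡ [])
mainTheorem3 p q 1≤q q<p = 0-bordered-repetition p q 1≤q q<p , 1-bordered-repetition p q 1≤q q<p
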